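{- Let $(P,\le,\mu,\gamma)$ be a preordered heap with target multiplication $\tau(a,b)=\gamma(\mu(\gamma a,\gamma b))$. If $e\in P$ is a left identity for $\mu$ (i.e. $\mu(e,a)\simeq a$ for all $a\in P$) or a right identity for $\mu$ (i.e. $\mu(a,e)\simeq a$ for all $a$), then $e$ is a double-sided identity for $\mu$ (i.e. $\mu(e,a)\simeq a\simeq\mu(a,e)$ for all $a$), and $\gamma e$ is a double-sided identity for $\tau$ (i.e. $\tau(\gamma e,a)\simeq a\simeq\tau(a,\gamma e)$ for all $a$). Analogously, if $e\in P$ is a left or right identity for $\tau$, then $e$ is a double-sided identity for $\tau$ and $\gamma e$ is a double-sided identity for $\mu$.
   Context: A preordered heap is a structure $(P,\le,\mu,\gamma)$ where $(P,\le)$ is a preorder (reflexive, transitive relation), $\mu\colon P\times P\to P$ (source multiplication) is monotone in each argument, and $\gamma\colon P\to P$ (involution) is antitone ($a\le b\Rightarrow \gamma b\le\gamma a$), such that: (A1) $\gamma(\gamma(a))=a$ for all $a$; (A2a) $\mu(a,\gamma(\mu(\gamma b,a)))\le b$ for all $a,b$; (A2b) $\mu(\gamma(\mu(a,\gamma b)),a)\le b$ for all $a,b$. Commutativity of $\mu$ is not assumed. For $a,b\in P$, $a\simeq b$ means $a\le b$ and $b\le a$. -}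

module Defs where

open import Level using (Level; suc; _⊔_)
open import Data.Product using (_×_)
open import Data.Sum using (_⊎_)
open import Relation.Binary.PropositionalEquality using (_≡_)
open import Relation.Binary.Structures using (IsPreorder)

record PreorderedHeap (c ℓ : Level) : Set (suc (c ⊔ ℓ)) where
  field
    Carrier    : Set c
    _≤_        : Carrier → Carrier → Set ℓ
    isPreorder : IsPreorder _≡_ _≤_
    μ          : Carrier → Carrier → Carrier
    γ          : Carrier → Carrier
    μ-monoˡ    : ∀ {a a′} b → a ≤ a′ → μ a b ≤ μ a′ b
    μ-monoʳ    : ∀ a {b b′} → b ≤ b′ → μ a b ≤ μ a b′
    γ-anti     : ∀ {a b} → a ≤ b → γ b ≤ γ a
    A1         : ∀ a → γ (γ a) ≡ a
    A2a        : ∀ a b → μ a (γ (μ (γ b) a)) ≤ b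
    A2b        : ∀ a b → μ (γ (μ a (γ b))) a ≤ b

  _≃_ : Carrier → Carrier → Set ℓ
  a ≃ b = (a ≤ b) × (b ≤ a)

  τ : Carrier → Carrier → Carrier
  τ a b = γ (μ (γ a) (γ b))

  LeftIdentity : (Carrier → Carrier → Carrier) → Carrier → Set (c ⊔ ℓ)
  LeftIdentity _∙_ e = ∀ a → (e ∙ a) ≃ a

  RightIdentity : (Carrier → Carrier → Carrier) → Carrier → Set (c ⊔ ℓ)
  RightIdentity _∙_ e = ∀ a → (a ∙ e) ≃ a

  DoubleIdentity : (Carrier → Carrier → Carrier) → Carrier → Set (c ⊔ ℓ)
  DoubleIdentity _∙_ e = ∀ a → ((e ∙ a) ≃ a) × (a ≃ (a ∙ e))

-- Evaluating the axiom A2a (resp. A2b) at a one-sided identity e of μ gives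
-- the inequalities missing for the other side; the reflection μ′ a b = μ b a
-- is again a preordered heap (it swaps A2a and A2b), so only one side needs
-- an argument. The involution γ is an anti-isomorphism exchanging μ and τ,
-- so identities of μ at e correspond to identities of τ at γ e.
module Submission where

open import Defs
open import Data.Product using (_×_; _,_; proj₁; proj₂; swap)
open import Data.Sum using (_⊎_; inj₁; inj₂)
open import Function using (flip)
open import Relation.Binary.Bundles using (Preorder)
open import Relation.Binary.PropositionalEquality
  using (_≡_; refl; sym; trans; cong₂; subst)
import Relation.Binary.Reasoning.Preorder as PreorderReasoning

opposite : ∀ {c ℓ} → PreorderedHeap c ℓ → PreorderedHeap c ℓ
opposite H = record
  { Carrier    = Carrier
  ; _≤_        = _≤_
  ; isPreorder = isPreorder
  ; μ          = flip μ
  ; γ          = γ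
  ; μ-monoˡ    = λ b → μ-monoʳ b
  ; μ-monoʳ    = λ a → μ-monoˡ a
  ; γ-anti     = γ-anti
  ; A1         = A1
  ; A2a        = A2b
  ; A2b        = A2a
  }
  where open PreorderedHeap H

module Properties {c ℓ} (H : PreorderedHeap c ℓ) where
  open PreorderedHeap H

  preorder : Preorder c c ℓ
  preorder = record { isPreorder = isPreorder }

  open PreorderReasoning preorder

  γ-swapˡ : ∀ {a b} → γ a ≤ b → γ b ≤ a
  γ-swapˡ {a} {b} p = subst (γ b ≤_) (A1 a) (γ-anti p)

  γ-swapʳ : ∀ {a b} → a ≤ γ b → b ≤ γ a
  γ-swapʳ {a} {b} p = subst (_≤ γ a) (A1 b) (γ-anti p)

  γ-cong-≃ : ∀ {a b} → a ≃ b → γ a ≃ γ b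
  γ-cong-≃ (p , q) = γ-anti q , γ-anti p

  γ-transpose-≃ : ∀ {a b} → a ≃ γ b → γ a ≃ b
  γ-transpose-≃ {b = b} p = subst (_ ≃_) (A1 b) (γ-cong-≃ p)

  left-right⇒doubleIdentity : ∀ _∙_ {e} →
    LeftIdentity _∙_ e → RightIdentity _∙_ e → DoubleIdentity _∙_ e
  left-right⇒doubleIdentity _ idˡ idʳ a = idˡ a , swap (idʳ a)

  leftIdentity⇒rightIdentity : ∀ {e} → LeftIdentity μ e → RightIdentity μ e
  leftIdentity⇒rightIdentity {e} idˡ a = μae≤a , subst (λ x → x ≤ μ x e) (A1 a) γγa≤μγγae
    where
    μae≤a : μ a e ≤ a
    μae≤a = begin
      μ a e                 ∼⟨ μ-monoˡ e (γ-swapʳ (proj₁ (idˡ (γ a)))) ⟩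
      μ (γ (μ e (γ a))) e   ∼⟨ A2b e a ⟩
      a                     ∎

    γγa≤μγγae : γ (γ a) ≤ μ (γ (γ a)) e
    γγa≤μγγae = γ-swapˡ (begin
      γ (μ (γ (γ a)) e)            ∼⟨ proj₂ (idˡ _) ⟩
      μ e (γ (μ (γ (γ a)) e))      ∼⟨ A2a e (γ a) ⟩
      γ a                          ∎)

  module Dual {_∙_ _∘_ : Carrier → Carrier → Carrier}
              (∙-dual : ∀ a b → a ∙ b ≡ γ (γ a ∘ γ b)) where

    leftIdentity : ∀ {e} → LeftIdentity _∘_ (γ e) → LeftIdentity _∙_ e
    leftIdentity {e} idˡ a = subst (_≃ a) (sym (∙-dual e a)) (γ-transpose-≃ (idˡ (γ a)))

    rightIdentity : ∀ {e} → RightIdentity _∘_ (γ e) → RightIdentity _∙_ e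
    rightIdentity {e} idʳ a = subst (_≃ a) (sym (∙-dual a e)) (γ-transpose-≃ (idʳ (γ a)))

    doubleIdentity : ∀ {e} → DoubleIdentity _∘_ (γ e) → DoubleIdentity _∙_ e
    doubleIdentity both = left-right⇒doubleIdentity _∙_
      (leftIdentity (λ a → proj₁ (both a)))
      (rightIdentity (λ a → swap (proj₂ (both a))))

  τ-dual : ∀ a b → τ a b ≡ γ (μ (γ a) (γ b))
  τ-dual a b = refl

  μ-dual : ∀ a b → μ a b ≡ γ (τ (γ a) (γ b))
  μ-dual a b = sym (trans (A1 _) (cong₂ μ (A1 a) (A1 b)))

  module τ-Dual = Dual {τ} {μ} τ-dual
  module μ-Dual = Dual {μ} {τ} μ-dual

rightIdentity⇒leftIdentity : ∀ {c ℓ} (H : PreorderedHeap c ℓ) →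
  let open PreorderedHeap H in ∀ {e} → RightIdentity μ e → LeftIdentity μ e
rightIdentity⇒leftIdentity H = Properties.leftIdentity⇒rightIdentity (opposite H)

module Identities {c ℓ} (H : PreorderedHeap c ℓ) where
  open PreorderedHeap H
  open Properties H

  μ-oneSided⇒doubleIdentity : ∀ {e} →
    LeftIdentity μ e ⊎ RightIdentity μ e → DoubleIdentity μ e
  μ-oneSided⇒doubleIdentity (inj₁ idˡ) =
    left-right⇒doubleIdentity μ idˡ (leftIdentity⇒rightIdentity idˡ)
  μ-oneSided⇒doubleIdentity (inj₂ idʳ) =
    left-right⇒doubleIdentity μ (rightIdentity⇒leftIdentity H idʳ) idʳ

  τ-oneSided⇒μ-oneSided : ∀ {e} →
    LeftIdentity τ e ⊎ RightIdentity τ e → LeftIdentity μ (γ e) ⊎ RightIdentity μ (γ e)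
  τ-oneSided⇒μ-oneSided {e} (inj₁ idˡ) =
    inj₁ (μ-Dual.leftIdentity (subst (LeftIdentity τ) (sym (A1 e)) idˡ))
  τ-oneSided⇒μ-oneSided {e} (inj₂ idʳ) =
    inj₂ (μ-Dual.rightIdentity (subst (RightIdentity τ) (sym (A1 e)) idʳ))

  μ-doubleIdentity⇒τ-doubleIdentity : ∀ {e} → DoubleIdentity μ e → DoubleIdentity τ (γ e)
  μ-doubleIdentity⇒τ-doubleIdentity {e} both =
    τ-Dual.doubleIdentity (subst (DoubleIdentity μ) (sym (A1 e)) both)

corollary2 : ∀ {c ℓ} (H : PreorderedHeap c ℓ) → let open PreorderedHeap H in
    ∀ (e : Carrier) →
      ((LeftIdentity μ e ⊎ RightIdentity μ e) →
        DoubleIdentity μ e × DoubleIdentity τ (γ e))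
      × ((LeftIdentity τ e ⊎ RightIdentity τ e) →
        DoubleIdentity τ e × DoubleIdentity μ (γ e))
corollary2 H e = forμ , forτ
  where
  open PreorderedHeap H
  open Identities H

  forμ : LeftIdentity μ e ⊎ RightIdentity μ e → DoubleIdentity μ e × DoubleIdentity τ (γ e)
  forμ oneSided = idμ , μ-doubleIdentity⇒τ-doubleIdentity idμ
    where
    idμ : DoubleIdentity μ e
    idμ = μ-oneSided⇒doubleIdentity oneSided

  forτ : LeftIdentity τ e ⊎ RightIdentity τ e → DoubleIdentity τ e × DoubleIdentity μ (γ e)
  forτ oneSided = subst (DoubleIdentity τ) (A1 e) (μ-doubleIdentity⇒τ-doubleIdentity idμ) , idμ
    where
    idμ : DoubleIdentity μ (γ e)
    idμ = μ-oneSided⇒doubleIdentity (τ-oneSided⇒μ-oneSided oneSided)
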